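{- Let $K$ be the absolute constant described in the context. There is an absolute constant $C$ such that the following holds. Let $d\ge 1$, $\epsilon>0$, and let $A\subseteq\{0,1\}^d$ satisfy $|A|\le 2^{d-1}$ and $|\partial(A)|\le(1+\epsilon)|A|$, and let $S$ be a coordinate cut with $|A\triangle S|\le K\epsilon 2^d$. Then $$|\partial(A)\triangle\partial(S)| = |\partial(A\triangle S)| \le C\cdot\epsilon 2^{d-1}.$$
   Context: $Q_d=(V,E)$ is the $d$-dimensional hypercube: $V=\{0,1\}^d$, edges join vertices at Hamming distance $1$. For $T\subseteq V$, $\partial(T)=E(T,V\setminus T)$ is the set of edges with exactly one endpoint in $T$. Coordinate cuts are the sets $S_{j,b}=\{x: x_j=b\}$, $j\in[d]$, $b\in\{0,1\}$. $K$ denotes an absolute constant (from a corollary of the Friedgut–Kalai–Naor theorem) with the property: for every $d$, every $\epsilon>0$ and every $A\subseteq V$ with $|A|\le 2^{d-1}$ and $|\partial(A)|\le (1+\epsilon)|A|$, there is a coordinate cut $S_{j,b}$ with $|A\triangle S_{j,b}|\le K\epsilon 2^d$.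
   Formalization: The parameter ε ranges over the positive rationals and the constant K over the rationals, and the constant C is taken in the rationals as well. -}

module Defs where

open import Data.Nat using (ℕ; zero; suc; _+_)
open import Data.Bool using (Bool; true; false; _xor_; not; if_then_else_)
open import Data.Fin using (Fin)
open import Data.Vec using (Vec; []; _∷_; lookup; updateAt)
open import Data.List using (List; []; _∷_; map; concatMap; filter; allFin)
open import Data.Nat.ListAction using (sum)
open import Data.Product using (_×_; _,_)
open import Data.Bool.Properties using () renaming (_≟_ to _≟ᵇ_)
open import Data.Integer using (+_)
open import Data.Rational using (ℚ; _/_)

Vertex : ℕ → Set
Vertex d = Vec Bool d

allVertices : (d : ℕ) → List (Vertex d)
allVertices zero    = [] ∷ []
allVertices (suc d) = map (false ∷_) (allVertices d) Data.List.++ map (true ∷_) (allVertices d)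

flipAt : ∀ {d} → Vertex d → Fin d → Vertex d
flipAt x i = updateAt x i not

-- An edge of Q_d is represented by its lower endpoint x and the direction i,
-- where x_i = 0; the edge joins x and flipAt x i.
Edge : ℕ → Set
Edge d = Vertex d × Fin d

allEdges : (d : ℕ) → List (Edge d)
allEdges d = concatMap (λ x → map (x ,_) (filter (λ i → lookup x i ≟ᵇ false) (allFin d))) (allVertices d)

VSet : ℕ → Set
VSet d = Vertex d → Bool

ESet : ℕ → Set
ESet d = Edge d → Bool

count : ∀ {X : Set} → (X → Bool) → List X → ℕ
count P xs = sum (map (λ x → if P x then 1 else 0) xs)

∣_∣ᵥ : ∀ {d} → VSet d → ℕ
∣_∣ᵥ {d} A = count A (allVertices d)

∣_∣ₑ : ∀ {d} → ESet d → ℕ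
∣_∣ₑ {d} F = count F (allEdges d)

_△ᵥ_ : ∀ {d} → VSet d → VSet d → VSet d
(A △ᵥ B) x = A x xor B x

_△ₑ_ : ∀ {d} → ESet d → ESet d → ESet d
(F △ₑ G) e = F e xor G e

∂ : ∀ {d} → VSet d → ESet d
∂ T (x , i) = T x xor T (flipAt x i)

coordCut : ∀ {d} → Fin d → Bool → VSet d
coordCut j b x = not (lookup x j xor b)

ℕ→ℚ : ℕ → ℚ
ℕ→ℚ n = (+ n) / 1

-- Write T = A △ S for the cut S = S_{j,b}. Since ∂ commutes with △ and ∂S is the perfect matching M_j of
-- direction-j edges (|M_j| = 2^{d-1}), counting edge by edge gives the identity
--   |∂T| + 2^{d-1} = |∂A| + 2 |M_j ∖ ∂A|,
-- and every edge of M_j ∖ ∂A = M_j ∩ ∂T has an endpoint in T, so |M_j ∖ ∂A| ≤ |T|. Hence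
--   |∂T| ≤ (1+ε)|A| + 2|T| - 2^{d-1} ≤ ε 2^{d-1} + 4Kε 2^{d-1},
-- which is the claim with C = 1 + 4K.
module Submission where

open import Defs
open import Data.Bool using (Bool; true; false; not; _xor_; _∧_; if_then_else_)
open import Data.Fin using (Fin; zero; suc)
open import Data.Fin.Properties using (_≟_)
open import Data.List using (List; []; _∷_; _++_; map; concatMap; filter; allFin)
open import Data.Product using (Σ; _×_; _,_)
open import Data.Vec using (_∷_; lookup)
open import Function using (_∘_)
open import Relation.Binary.PropositionalEquality
open import Relation.Nullary using (does; yes; no)
open import Relation.Unary using (Decidable)
open import Data.Bool.Properties using (xor-∧-commutativeRing; xor-same) renaming (_≟_ to _≟ᵇ_)
open import Algebra.Bundles using (CommutativeRing)
open import Algebra.Properties.CommutativeSemigroup (CommutativeRing.+-commutativeSemigroup xor-∧-commutativeRing)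
  using () renaming (interchange to xor-interchange)
open import Data.Vec.Properties using (lookup∘updateAt; lookup∘updateAt′)

inDirection : ∀ {d} → Fin d → ESet d
inDirection j (x , i) = does (i ≟ j)

_∩ₑ_ : ∀ {d} → ESet d → ESet d → ESet d
(F ∩ₑ G) e = F e ∧ G e

∂-△ : ∀ {d} (A B : VSet d) e → ∂ (A △ᵥ B) e ≡ (∂ A △ₑ ∂ B) e
∂-△ A B (x , i) = xor-interchange (A x) (B x) (A (flipAt x i)) (B (flipAt x i))

∂-coordCut : ∀ {d} (j : Fin d) b e → ∂ (coordCut j b) e ≡ inDirection j e
∂-coordCut j b (x , i) with i ≟ j
... | yes refl rewrite lookup∘updateAt i {not} x = cut-separates (lookup x i) b
  where
  cut-separates : ∀ a b → not (a xor b) xor not (not a xor b) ≡ true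
  cut-separates true  true  = refl
  cut-separates true  false = refl
  cut-separates false true  = refl
  cut-separates false false = refl
... | no i≢j rewrite lookup∘updateAt′ j i {not} (i≢j ∘ sym) x = xor-same (not (lookup x j xor b))

module Counting where

  open import Data.Nat using (ℕ; zero; suc; _+_; _≤_; _^_; z≤n)
  open import Data.Nat.Properties
    using (+-identityʳ; +-mono-≤; +-monoʳ-≤; ≤-refl; ≤-reflexive; ≤-trans; +-commutativeSemigroup; module ≤-Reasoning)
  open import Algebra.Properties.CommutativeSemigroup +-commutativeSemigroup using (interchange)
  open import Data.Bool.Properties using (if-eta)
  open import Data.Nat.ListAction using (sum)
  open import Data.Nat.ListAction.Properties using (sum-++)
  open import Data.List.Properties using (map-++; map-∘; map-cong; map-tabulate)

  private variable
    X Y : Set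

  𝟙 : Bool → ℕ
  𝟙 b = if b then 1 else 0

  ∑ : List X → (X → ℕ) → ℕ
  ∑ xs f = sum (map f xs)

  syntax ∑ xs (λ x → e) = ∑[ x ∈ xs ] e

  ∑-++ : ∀ (xs ys : List X) f → ∑ (xs ++ ys) f ≡ ∑ xs f + ∑ ys f
  ∑-++ xs ys f = trans (cong sum (map-++ f xs ys)) (sum-++ (map f xs) (map f ys))

  ∑-map : ∀ (g : X → Y) xs f → ∑ (map g xs) f ≡ ∑ xs (f ∘ g)
  ∑-map g xs f = cong sum (sym (map-∘ xs))

  ∑-concatMap : ∀ (g : X → List Y) xs f → ∑ (concatMap g xs) f ≡ ∑[ x ∈ xs ] ∑ (g x) f
  ∑-concatMap g []       f = refl
  ∑-concatMap g (x ∷ xs) f = trans (∑-++ (g x) (concatMap g xs) f) (cong (∑ (g x) f +_) (∑-concatMap g xs f))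

  ∑-cong : ∀ xs {f g : X → ℕ} → (∀ x → f x ≡ g x) → ∑ xs f ≡ ∑ xs g
  ∑-cong xs f≗g = cong sum (map-cong f≗g xs)

  ∑-mono-≤ : ∀ xs {f g : X → ℕ} → (∀ x → f x ≤ g x) → ∑ xs f ≤ ∑ xs g
  ∑-mono-≤ []       f≤g = z≤n
  ∑-mono-≤ (x ∷ xs) f≤g = +-mono-≤ (f≤g x) (∑-mono-≤ xs f≤g)

  ∑-distrib-+ : ∀ xs (f g : X → ℕ) → ∑[ x ∈ xs ] (f x + g x) ≡ ∑ xs f + ∑ xs g
  ∑-distrib-+ []       f g = refl
  ∑-distrib-+ (x ∷ xs) f g =
    trans (cong (f x + g x +_) (∑-distrib-+ xs f g)) (interchange (f x) (g x) (∑ xs f) (∑ xs g))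

  ∑-zero : ∀ (xs : List X) → ∑[ x ∈ xs ] 0 ≡ 0
  ∑-zero []       = refl
  ∑-zero (x ∷ xs) = ∑-zero xs

  ∑-filter : ∀ {P : X → Set} (P? : Decidable P) xs f →
    ∑ (filter P? xs) f ≡ ∑[ x ∈ xs ] (if does (P? x) then f x else 0)
  ∑-filter P? []       f = refl
  ∑-filter P? (x ∷ xs) f with does (P? x)
  ... | true  = cong (f x +_) (∑-filter P? xs f)
  ... | false = ∑-filter P? xs f

  count-cong : ∀ {P Q : X → Bool} → (∀ x → P x ≡ Q x) → ∀ xs → count P xs ≡ count Q xs
  count-cong P≗Q xs = ∑-cong xs (cong 𝟙 ∘ P≗Q)

  -- Q ∧ (P xor Q) is Q ∖ P, written so that it becomes ∂S ∩ ∂(A △ S) for P = ∂A, Q = ∂S.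
  count-xor-+ : ∀ {X : Set} (P Q : X → Bool) xs →
    count (λ x → P x xor Q x) xs + count Q xs
      ≡ count P xs + (count (λ x → Q x ∧ (P x xor Q x)) xs + count (λ x → Q x ∧ (P x xor Q x)) xs)
  count-xor-+ {X} P Q xs = begin
    count (λ x → P x xor Q x) xs + count Q xs ≡⟨ ∑-distrib-+ xs _ _ ⟨
    ∑[ x ∈ xs ] (𝟙 (P x xor Q x) + 𝟙 (Q x))   ≡⟨ ∑-cong xs (λ x → pointwise (P x) (Q x)) ⟩
    ∑[ x ∈ xs ] (𝟙 (P x) + (𝟙 (R x) + 𝟙 (R x))) ≡⟨ ∑-distrib-+ xs _ _ ⟩
    count P xs + ∑[ x ∈ xs ] (𝟙 (R x) + 𝟙 (R x)) ≡⟨ cong (count P xs +_) (∑-distrib-+ xs _ _) ⟩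
    count P xs + (count R xs + count R xs) ∎
    where
    open ≡-Reasoning
    R : X → Bool
    R x = Q x ∧ (P x xor Q x)
    pointwise : ∀ a s → 𝟙 (a xor s) + 𝟙 s ≡ 𝟙 a + (𝟙 (s ∧ (a xor s)) + 𝟙 (s ∧ (a xor s)))
    pointwise true  true  = refl
    pointwise true  false = refl
    pointwise false true  = refl
    pointwise false false = refl

  ∑-allFin-suc : ∀ d (f : Fin (suc d) → ℕ) → ∑ (allFin (suc d)) f ≡ f zero + ∑[ i ∈ allFin d ] f (suc i)
  ∑-allFin-suc d f = cong (λ ns → f zero + sum ns)
    (trans (map-tabulate suc f) (sym (map-tabulate (λ i → i) (f ∘ suc))))

  ∑-allFin-if≟ : ∀ {d} (j : Fin d) c → ∑[ i ∈ allFin d ] (if does (i ≟ j) then c else 0) ≡ c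
  ∑-allFin-if≟ {suc d} zero    c = trans (∑-allFin-suc d (λ i → if does (i ≟ zero) then c else 0))
    (trans (cong (c +_) (∑-zero (allFin d))) (+-identityʳ c))
  ∑-allFin-if≟ {suc d} (suc j) c = trans (∑-allFin-suc d (λ i → if does (i ≟ suc j) then c else 0))
    (∑-allFin-if≟ j c)

  ∑-allVertices-suc : ∀ d (g : Vertex (suc d) → ℕ) →
    ∑ (allVertices (suc d)) g ≡ ∑[ y ∈ allVertices d ] g (false ∷ y) + ∑[ y ∈ allVertices d ] g (true ∷ y)
  ∑-allVertices-suc d g = trans (∑-++ (map (false ∷_) (allVertices d)) _ g)
    (cong₂ _+_ (∑-map (false ∷_) (allVertices d) g) (∑-map (true ∷_) (allVertices d) g))

  ∑-allVertices-1 : ∀ d → ∑[ x ∈ allVertices d ] 1 ≡ 2 ^ d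
  ∑-allVertices-1 zero    = refl
  ∑-allVertices-1 (suc d) = trans (∑-allVertices-suc d _)
    (trans (cong₂ _+_ (∑-allVertices-1 d) (∑-allVertices-1 d)) (cong (2 ^ d +_) (sym (+-identityʳ (2 ^ d)))))

  isLower : ∀ {d} → Fin d → Vertex d → Bool
  isLower i x = does (lookup x i ≟ᵇ false)

  ∑-allEdges : ∀ d (f : Edge d → ℕ) →
    ∑ (allEdges d) f ≡ ∑[ x ∈ allVertices d ] ∑[ i ∈ allFin d ] (if isLower i x then f (x , i) else 0)
  ∑-allEdges d f = trans (∑-concatMap _ (allVertices d) f) (∑-cong (allVertices d) λ x →
    trans (∑-map (x ,_) (filter (λ i → lookup x i ≟ᵇ false) (allFin d)) f)
          (∑-filter (λ i → lookup x i ≟ᵇ false) (allFin d) (λ i → f (x , i))))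

  ∑-inDirection : ∀ {d} (j : Fin d) (g : Edge d → ℕ) →
    ∑[ e ∈ allEdges d ] (if inDirection j e then g e else 0)
      ≡ ∑[ x ∈ allVertices d ] (if isLower j x then g (x , j) else 0)
  ∑-inDirection {d} j g = trans (∑-allEdges d _) (∑-cong (allVertices d) λ x →
    trans (∑-cong (allFin d) (only-j x)) (∑-allFin-if≟ j _))
    where
    only-j : ∀ x i → (if isLower i x then (if does (i ≟ j) then g (x , i) else 0) else 0)
                   ≡ (if does (i ≟ j) then (if isLower j x then g (x , j) else 0) else 0)
    only-j x i with i ≟ j
    ... | yes refl = refl
    ... | no _     = if-eta (isLower i x)

  ∑-lowerEndpoints : ∀ {d} (j : Fin d) (g : Vertex d → ℕ) →
    ∑[ x ∈ allVertices d ] (if isLower j x then g x + g (flipAt x j) else 0) ≡ ∑ (allVertices d) g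
  ∑-lowerEndpoints {suc d} zero g = trans (∑-allVertices-suc d _)
    (trans (cong₂ _+_ (∑-distrib-+ (allVertices d) _ _) (∑-zero (allVertices d)))
    (trans (+-identityʳ _) (sym (∑-allVertices-suc d g))))
  ∑-lowerEndpoints {suc d} (suc j) g = trans (∑-allVertices-suc d _)
    (trans (cong₂ _+_ (∑-lowerEndpoints j _) (∑-lowerEndpoints j _)) (sym (∑-allVertices-suc d g)))

  ∑-isLower : ∀ d (j : Fin (suc d)) → ∑[ x ∈ allVertices (suc d) ] (if isLower j x then 1 else 0) ≡ 2 ^ d
  ∑-isLower d zero = trans (∑-allVertices-suc d _)
    (trans (cong₂ _+_ (∑-allVertices-1 d) (∑-zero (allVertices d))) (+-identityʳ _))
  ∑-isLower (suc d) (suc j) = trans (∑-allVertices-suc (suc d) _)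
    (trans (cong₂ _+_ (∑-isLower d j) (∑-isLower d j)) (cong (2 ^ d +_) (sym (+-identityʳ _))))

  ∣inDirection∣ₑ≡2^d : ∀ d (j : Fin (suc d)) → ∣ inDirection j ∣ₑ ≡ 2 ^ d
  ∣inDirection∣ₑ≡2^d d j = trans (∑-inDirection j (λ _ → 1)) (∑-isLower d j)

  -- The direction-j edges form a perfect matching, so each edge of ∂T among them is charged to its endpoint in T.
  ∣inDirection∩∂∣ₑ≤∣∣ᵥ : ∀ {d} (j : Fin d) (T : VSet d) → ∣ inDirection j ∩ₑ ∂ T ∣ₑ ≤ ∣ T ∣ᵥ
  ∣inDirection∩∂∣ₑ≤∣∣ᵥ {d} j T = begin
    ∣ inDirection j ∩ₑ ∂ T ∣ₑ
      ≡⟨ ∑-cong (allEdges d) (λ e → 𝟙-∧ (inDirection j e) (∂ T e)) ⟩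
    ∑[ e ∈ allEdges d ] (if inDirection j e then 𝟙 (∂ T e) else 0)
      ≡⟨ ∑-inDirection j (𝟙 ∘ ∂ T) ⟩
    ∑[ x ∈ allVertices d ] (if isLower j x then 𝟙 (∂ T (x , j)) else 0)
      ≤⟨ ∑-mono-≤ (allVertices d) (λ x → if-mono-≤ (isLower j x) (𝟙-xor-≤ (T x) (T (flipAt x j)))) ⟩
    ∑[ x ∈ allVertices d ] (if isLower j x then 𝟙 (T x) + 𝟙 (T (flipAt x j)) else 0)
      ≡⟨ ∑-lowerEndpoints j (𝟙 ∘ T) ⟩
    ∣ T ∣ᵥ ∎
    where
    open ≤-Reasoning
    𝟙-∧ : ∀ a b → 𝟙 (a ∧ b) ≡ (if a then 𝟙 b else 0)
    𝟙-∧ true  b = refl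
    𝟙-∧ false b = refl
    𝟙-xor-≤ : ∀ a b → 𝟙 (a xor b) ≤ 𝟙 a + 𝟙 b
    𝟙-xor-≤ true  true  = z≤n
    𝟙-xor-≤ true  false = ≤-refl
    𝟙-xor-≤ false b     = ≤-refl
    if-mono-≤ : ∀ c {m n} → m ≤ n → (if c then m else 0) ≤ (if c then n else 0)
    if-mono-≤ true  m≤n = m≤n
    if-mono-≤ false m≤n = z≤n

  ∣∂[A△S]∣+2^d≤ : ∀ {d} (A : VSet (suc d)) (j : Fin (suc d)) b →
    ∣ ∂ (A △ᵥ coordCut j b) ∣ₑ + 2 ^ d ≤ ∣ ∂ A ∣ₑ + (∣ A △ᵥ coordCut j b ∣ᵥ + ∣ A △ᵥ coordCut j b ∣ᵥ)
  ∣∂[A△S]∣+2^d≤ {d} A j b = begin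
    ∣ ∂ T ∣ₑ + 2 ^ d                  ≡⟨ cong₂ _+_ (count-cong (∂-△ A S) edges) (sym ∣∂S∣≡2^d) ⟩
    ∣ ∂ A △ₑ ∂ S ∣ₑ + ∣ ∂ S ∣ₑ        ≡⟨ count-xor-+ (∂ A) (∂ S) edges ⟩
    ∣ ∂ A ∣ₑ + (∣ M ∣ₑ + ∣ M ∣ₑ)      ≤⟨ +-monoʳ-≤ ∣ ∂ A ∣ₑ (+-mono-≤ ∣M∣≤∣T∣ ∣M∣≤∣T∣) ⟩
    ∣ ∂ A ∣ₑ + (∣ T ∣ᵥ + ∣ T ∣ᵥ)      ∎
    where
    open ≤-Reasoning
    S = coordCut j b
    T = A △ᵥ S
    M = ∂ S ∩ₑ (∂ A △ₑ ∂ S)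
    edges = allEdges (suc d)
    ∣∂S∣≡2^d : ∣ ∂ S ∣ₑ ≡ 2 ^ d
    ∣∂S∣≡2^d = trans (count-cong (∂-coordCut j b) edges) (∣inDirection∣ₑ≡2^d d j)
    ∣M∣≤∣T∣ : ∣ M ∣ₑ ≤ ∣ T ∣ᵥ
    ∣M∣≤∣T∣ = ≤-trans (≤-reflexive (count-cong (λ e → cong₂ _∧_ (∂-coordCut j b e) (sym (∂-△ A S e))) edges))
                     (∣inDirection∩∂∣ₑ≤∣∣ᵥ j T)

module RationalBounds where

  import Data.Nat as ℕ
  open import Data.Integer as ℤ using (+_)
  import Data.Integer.Properties as ℤ
  import Data.Nat.Coprimality as Coprime
  open import Data.Rational using (ℚ; mkℚ; _+_; _*_; -_; _<_; 0ℚ; 1ℚ; *≤*; NonNegative; nonNegative) renaming (_≤_ to _≤ℚ_)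
  open import Data.Rational.Properties
  open import Data.Rational.Solver using (module +-*-Solver)
  open +-*-Solver

  ℕ→ℚ≡mkℚ : ∀ n → ℕ→ℚ n ≡ mkℚ (+ n) 0 (Coprime.sym (Coprime.1-coprimeTo n))
  ℕ→ℚ≡mkℚ n = ↥p/↧p≡p _

  ℕ→ℚ-+ : ∀ m n → ℕ→ℚ (m ℕ.+ n) ≡ ℕ→ℚ m + ℕ→ℚ n
  ℕ→ℚ-+ m n rewrite ℕ→ℚ≡mkℚ m | ℕ→ℚ≡mkℚ n =
    /-cong (sym (cong₂ ℤ._+_ (ℤ.*-identityʳ (+ m)) (ℤ.*-identityʳ (+ n)))) refl

  ℕ→ℚ-mono-≤ : ∀ {m n} → m ℕ.≤ n → ℕ→ℚ m ≤ℚ ℕ→ℚ n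
  ℕ→ℚ-mono-≤ {m} {n} m≤n rewrite ℕ→ℚ≡mkℚ m | ℕ→ℚ≡mkℚ n =
    *≤* (subst₂ ℤ._≤_ (sym (ℤ.*-identityʳ (+ m))) (sym (ℤ.*-identityʳ (+ n))) (ℤ.+≤+ m≤n))

  boundConstant : ℚ → ℚ
  boundConstant K = 1ℚ + ((K + K) + (K + K))

  excess-bound : ∀ K {ε} → 0ℚ < ε → ∀ {x h a t α} →
    x + h ≤ℚ a + (t + t) → a ≤ℚ (1ℚ + ε) * α → α ≤ℚ h → t ≤ℚ K * ε * (h + h) →
    x ≤ℚ boundConstant K * ε * h
  excess-bound K {ε} 0<ε {x} {h} {a} {t} x+h≤a+2t a≤[1+ε]α α≤h t≤Kε2h = begin
    x                                 ≡⟨ solve 2 (λ x h → x := (x :+ h) :+ (:- h)) refl x h ⟩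
    (x + h) + - h                     ≤⟨ +-monoˡ-≤ (- h) x+h≤h+CKεh ⟩
    (h + boundConstant K * ε * h) + - h ≡⟨ solve 2 (λ h y → (h :+ y) :+ (:- h) := y) refl h (boundConstant K * ε * h) ⟩
    boundConstant K * ε * h           ∎
    where
    open ≤-Reasoning
    instance
      1+ε-nonNeg : NonNegative (1ℚ + ε)
      1+ε-nonNeg = nonNegative (+-mono-≤ {0ℚ} {1ℚ} (*≤* (ℤ.+≤+ ℕ.z≤n)) (<⇒≤ 0<ε))
    x+h≤h+CKεh : x + h ≤ℚ h + boundConstant K * ε * h
    x+h≤h+CKεh = begin
      x + h
        ≤⟨ x+h≤a+2t ⟩
      a + (t + t)
        ≤⟨ +-mono-≤ (≤-trans a≤[1+ε]α (*-monoˡ-≤-nonNeg (1ℚ + ε) α≤h)) (+-mono-≤ t≤Kε2h t≤Kε2h) ⟩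
      (1ℚ + ε) * h + (K * ε * (h + h) + K * ε * (h + h))
        ≡⟨ solve 3 (λ k e h → (con 1ℚ :+ e) :* h :+ (k :* e :* (h :+ h) :+ k :* e :* (h :+ h))
                            := h :+ (con 1ℚ :+ ((k :+ k) :+ (k :+ k))) :* e :* h) refl K ε h ⟩
      h + boundConstant K * ε * h
        ∎

open Counting using (count-cong; ∣∂[A△S]∣+2^d≤)
open RationalBounds using (ℕ→ℚ-+; ℕ→ℚ-mono-≤; boundConstant; excess-bound)
open import Data.Nat as ℕ using (ℕ; zero; suc; _≤_; _^_; _∸_)
open import Data.Nat.Properties using (+-identityʳ)
open import Data.Rational using (ℚ; _+_; _*_; _<_; 0ℚ; 1ℚ) renaming (_≤_ to _≤ℚ_)

∣∂[A△S]∣-bound : ∀ K {d} {ε} → 0ℚ < ε → (A : VSet (suc d)) →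
  ∣ A ∣ᵥ ≤ 2 ^ d →
  ℕ→ℚ ∣ ∂ A ∣ₑ ≤ℚ (1ℚ + ε) * ℕ→ℚ ∣ A ∣ᵥ →
  ∀ j b → ℕ→ℚ ∣ A △ᵥ coordCut j b ∣ᵥ ≤ℚ K * ε * ℕ→ℚ (2 ^ suc d) →
  ℕ→ℚ ∣ ∂ (A △ᵥ coordCut j b) ∣ₑ ≤ℚ boundConstant K * ε * ℕ→ℚ (2 ^ d)
∣∂[A△S]∣-bound K {d} {ε} 0<ε A ∣A∣≤2^d ∣∂A∣≤[1+ε]∣A∣ j b ∣T∣≤Kε2^[d+1] =
  excess-bound K 0<ε excess ∣∂A∣≤[1+ε]∣A∣ (ℕ→ℚ-mono-≤ ∣A∣≤2^d)
    (subst (λ q → ℕ→ℚ ∣ A △ᵥ coordCut j b ∣ᵥ ≤ℚ K * ε * q) ℕ→ℚ-2^[d+1] ∣T∣≤Kε2^[d+1])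
  where
  ℕ→ℚ-2^[d+1] : ℕ→ℚ (2 ^ suc d) ≡ ℕ→ℚ (2 ^ d) + ℕ→ℚ (2 ^ d)
  ℕ→ℚ-2^[d+1] = trans (cong (λ n → ℕ→ℚ (2 ^ d ℕ.+ n)) (+-identityʳ (2 ^ d))) (ℕ→ℚ-+ (2 ^ d) (2 ^ d))
  T = A △ᵥ coordCut j b
  excess : ℕ→ℚ ∣ ∂ T ∣ₑ + ℕ→ℚ (2 ^ d) ≤ℚ ℕ→ℚ ∣ ∂ A ∣ₑ + (ℕ→ℚ ∣ T ∣ᵥ + ℕ→ℚ ∣ T ∣ᵥ)
  excess = subst₂ _≤ℚ_ (ℕ→ℚ-+ ∣ ∂ T ∣ₑ (2 ^ d))
                 (trans (ℕ→ℚ-+ ∣ ∂ A ∣ₑ _) (cong (ℕ→ℚ ∣ ∂ A ∣ₑ +_) (ℕ→ℚ-+ ∣ T ∣ᵥ ∣ T ∣ᵥ)))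
                 (ℕ→ℚ-mono-≤ (∣∂[A△S]∣+2^d≤ A j b))

lemma4 : (K : ℚ) → Σ ℚ λ C →
    (d : ℕ) → 1 ≤ d → (ε : ℚ) → 0ℚ < ε → (A : VSet d) →
    ∣ A ∣ᵥ ≤ 2 ^ (d ∸ 1) →
    ℕ→ℚ ∣ ∂ A ∣ₑ ≤ℚ (1ℚ + ε) * ℕ→ℚ ∣ A ∣ᵥ →
    (j : Fin d) → (b : Bool) →
    ℕ→ℚ ∣ A △ᵥ coordCut j b ∣ᵥ ≤ℚ K * ε * ℕ→ℚ (2 ^ d) →
    (∣ ∂ A △ₑ ∂ (coordCut j b) ∣ₑ ≡ ∣ ∂ (A △ᵥ coordCut j b) ∣ₑ)
      × (ℕ→ℚ ∣ ∂ (A △ᵥ coordCut j b) ∣ₑ ≤ℚ C * ε * ℕ→ℚ (2 ^ (d ∸ 1)))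
lemma4 K = boundConstant K , λ where
  zero ()
  (suc d) _ _ 0<ε A ∣A∣≤ ∣∂A∣≤ j b ∣A△S∣≤ →
      count-cong (λ e → sym (∂-△ A (coordCut j b) e)) (allEdges (suc d))
    , ∣∂[A△S]∣-bound K 0<ε A ∣A∣≤ ∣∂A∣≤ j b ∣A△S∣≤
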